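{- Let $g:\mathbb{R}^+\times\mathbb{N}\to\mathbb{N}$ be an arbitrary function, and define $f:\mathbb{N}\to\mathbb{N}$ by $f(k)=2g\left(\frac{1}{4k+4},k\right)$. If $\mathcal{G}$ is a fractionally $(\mathrm{Be},g)$-fragile class of graphs, then the expansion of $\mathcal{G}$ is bounded by $f$.
   Context: For a graph $G$ and $k\ge0$, a $k$-minor of $G$ is any graph obtained from $G$ by contracting pairwise vertex-disjoint connected subgraphs of radius at most $k$ and removing vertices and edges; $\nabla_k(G)=\max\{|E(G')|/|V(G')|: G'\text{ a }k\text{ -minor of }G\}$, and $\nabla_k(\mathcal{G})$ is its supremum over $G\in\mathcal{G}$. A function $f$ bounds the expansion of $\mathcal{G}$ if $f(k)\ge\nabla_k(\mathcal{G})$ for all integers $k\ge0$. For $h:\mathbb{N}\to\mathbb{N}$, $\mathrm{Ex}(h)$ is the class of all graphs $G$ with $\nabla_k(G)\le h(k)$ for all $k\ge0$. For a graph $G$ and class $\mathcal{C}$, let $G-\mathcal{C}=\{X\subseteq V(G):G-X\in\mathcal{C}\}$; a fractional $\mathcal{C}$-complementary packing in $G$ is a map $\pi:G-\mathcal{C}\to[0,1]$ with $\sum_X\pi(X)=1$, and its thickness is $\max_{v\in V(G)}\sum_{X\ni v}\pi(X)$. $\mathcal{G}$ is fractionally $(\mathrm{Be},g)$-fragile if for every $\varepsilon>0$, every graph in $\mathcal{G}$ has a fractional $\mathrm{Ex}(g(\varepsilon,\cdot))$-complementary packing of thickness at most $\varepsilon$.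
   Formalization: The function g is taken on positive rationals and naturals instead of $\mathbb{R}^+\times\mathbb{N}$, so ε ranges over positive rationals, and the fractional complementary packings take rational values. -}

module Defs where

open import Data.Bool using (Bool; true; false; not; _∧_; if_then_else_)
open import Data.Nat as ℕ using (ℕ; zero; suc; _≤_; _<ᵇ_; _*_)
open import Data.Fin using (Fin; toℕ)
open import Data.Fin.Subset using (Subset)
open import Data.Nat.ListAction using (sum)
open import Data.List using (List; []; _∷_; map; foldr; filterᵇ; allFin; length; lookup)
open import Data.Vec as Vec using ()
open import Data.Maybe using (Maybe; just)
open import Data.Product using (Σ; _×_; _,_; ∃; ∃-syntax)
open import Data.Integer using (+_)
open import Data.Rational as ℚ using (ℚ; 0ℚ; 1ℚ; _+_; _/_)
import Data.Rational.Properties as ℚP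
open import Relation.Binary.PropositionalEquality using (_≡_; refl; trans)

record Graph : Set where
  field
    n      : ℕ
    adj    : Fin n → Fin n → Bool
    sym    : ∀ i j → adj i j ≡ adj j i
    irrefl : ∀ i → adj i i ≡ false
open Graph public

∣E∣ : Graph → ℕ
∣E∣ G = sum (map (λ i → sum (map (λ j →
          if (toℕ i <ᵇ toℕ j) ∧ adj G i j then 1 else 0) (allFin (n G)))) (allFin (n G)))

∣V∣ : Graph → ℕ
∣V∣ G = n G

data WalkIn (G : Graph) (P : Fin (n G) → Set) : Fin (n G) → Fin (n G) → ℕ → Set where
  here : ∀ {v} → P v → WalkIn G P v v 0
  step : ∀ {u w v ℓ} → P u → adj G u w ≡ true → WalkIn G P w v ℓ → WalkIn G P u v (suc ℓ)

-- H is a k-minor of G: there are pairwise vertex-disjoint branch sets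
-- B_u (u ∈ V(H)) in G (encoded by a partial map φ : V(G) → V(H), so that
-- B_u = φ⁻¹(u); vertices mapped to nothing are deleted), each B_u inducing
-- a connected subgraph of radius at most k (it has a centre from which every
-- vertex of B_u is reachable inside G[B_u] by a walk of length ≤ k), and every
-- edge uw of H is realised by an edge of G between B_u and B_w
-- (edges of the contracted graph not in H are removed).

record _IsMinorAtDepth_Of_ (H : Graph) (k : ℕ) (G : Graph) : Set where
  field
    φ        : Fin (n G) → Maybe (Fin (n H))
    centre   : Fin (n H) → Fin (n G)
    centreIn : ∀ u → φ (centre u) ≡ just u
    radius   : ∀ u v → φ v ≡ just u →
               ∃[ ℓ ] (ℓ ≤ k × WalkIn G (λ x → φ x ≡ just u) (centre u) v ℓ)
    edges    : ∀ u w → adj H u w ≡ true →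
               ∃[ x ] ∃[ y ] (φ x ≡ just u × φ y ≡ just w × adj G x y ≡ true)

-- ∇_k(G) ≤ c   (for natural c):  |E(H)| / |V(H)| ≤ c for every k-minor H of G
-- (written multiplicatively; for |V(H)| = 0 also |E(H)| = 0).
∇_≤_ : Graph → ℕ → ℕ → Set
(∇ G ≤ k) c = ∀ (H : Graph) → H IsMinorAtDepth k Of G → ∣E∣ H ≤ c * ∣V∣ H

GraphClass : Set₁
GraphClass = Graph → Set

Ex : (ℕ → ℕ) → GraphClass
Ex h G = ∀ k → (∇ G ≤ k) (h k)

ExpansionBoundedBy : GraphClass → (ℕ → ℕ) → Set
ExpansionBoundedBy 𝒢 f = ∀ G → 𝒢 G → ∀ k → (∇ G ≤ k) (f k)

-- G - X : induced subgraph on V(G) ∖ X  (X as a Subset = Vec Bool, true = in X)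

remaining : ∀ {m} → Subset m → List (Fin m)
remaining {m} X = filterᵇ (λ v → not (Vec.lookup X v)) (allFin m)

_∖_ : (G : Graph) → Subset (n G) → Graph
G ∖ X = record
  { n      = length (remaining X)
  ; adj    = λ i j → adj G (emb i) (emb j)
  ; sym    = λ i j → sym G (emb i) (emb j)
  ; irrefl = λ i → irrefl G (emb i)
  }
  where emb = lookup (remaining X)

ℚsum : List ℚ → ℚ
ℚsum = foldr _+_ 0ℚ

allSubsets : ∀ m → List (Subset m)
allSubsets zero    = Vec.[] ∷ []
allSubsets (suc m) = map (true Vec.∷_) (allSubsets m) Data.List.++ map (false Vec.∷_) (allSubsets m)

-- A fractional 𝒞-complementary packing of G of thickness ≤ ε:
-- π : G - 𝒞 → [0,1] (extended by 0 outside G - 𝒞), total weight 1, and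
-- every vertex v has Σ_{X ∋ v} π(X) ≤ ε.
record FracPacking (𝒞 : GraphClass) (G : Graph) (ε : ℚ) : Set where
  field
    π         : Subset (n G) → ℚ
    support   : ∀ X → 0ℚ ℚ.< π X → 𝒞 (G ∖ X)
    nonneg    : ∀ X → 0ℚ ℚ.≤ π X
    le1       : ∀ X → π X ℚ.≤ 1ℚ
    total     : ℚsum (map π (allSubsets (n G))) ≡ 1ℚ
    thickness : ∀ v → ℚsum (map π (filterᵇ (λ X → Vec.lookup X v) (allSubsets (n G)))) ℚ.≤ ε

-- positive rationals (stand-in for ℝ⁺)
record ℚ⁺ : Set where
  constructor _,⁺_
  field
    val : ℚ
    pos : 0ℚ ℚ.< val
open ℚ⁺ public

FractionallyBeFragile : GraphClass → (ℚ⁺ → ℕ → ℕ) → Set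
FractionallyBeFragile 𝒢 g =
  ∀ (ε : ℚ⁺) G → 𝒢 G → FracPacking (Ex (g ε)) G (val ε)

inv4k4 : ℕ → ℚ⁺
inv4k4 k = ((+ 1) / suc (4 * k ℕ.+ 3)) ,⁺
           ℚP.positive⁻¹ _ {{ℚP.normalize-pos 1 (suc (4 * k ℕ.+ 3))}}

fOf : (ℚ⁺ → ℕ → ℕ) → ℕ → ℕ
fOf g k = 2 * g (inv4k4 k) k

module Submission where

-- Fix k, a k-minor H of a graph G in the class, and ε = 1/(4k+4). Realise each edge uw of H by an
-- edge xy of G together with walks of length at most k from the centres of the branch sets of u and w
-- to x and y; these 2(k+1) vertices are the witness of uw. For a set X in the support of the packing,
-- delete from H every edge whose witness meets X and every vertex whose centre lies in X. What remains
-- is a k-minor of G - X, whose branch sets are the vertices still reachable from their centres within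
-- k steps, so it has at most g(ε, k) |V(H)| edges. Thus |E(H)| ≤ g(ε, k) |V(H)| + |X ∩ witnesses| on
-- the support of the packing. Averaging over the packing and using its thickness gives
-- |E(H)| ≤ g(ε, k) |V(H)| + ε · 2(k+1) |E(H)| = g(ε, k) |V(H)| + |E(H)| / 2.

open import Defs
open import Algebra.Bundles using (CommutativeMonoid)
import Algebra.Properties.CommutativeSemigroup as CommutativeSemigroupProperties
open import Data.Bool as Bool using (Bool; true; false; not; _∧_; _∨_; if_then_else_; T; T?)
open import Data.Bool.ListAction using (all; any)
open import Data.Bool.Properties
  using (T-∧; T-∨; T-≡; ∧-zeroʳ; ∧-identityʳ; ∧-conicalˡ; ∧-conicalʳ; not-injective; ¬-not)
open import Data.Empty using (⊥-elim)
open import Data.Fin as Fin using (Fin; toℕ)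
open import Data.Fin.Properties using (toℕ-injective)
open import Data.Fin.Subset using (Subset)
import Data.Integer as ℤ
import Data.Integer.Properties as ℤ
open import Data.List using (List; []; _∷_; _++_; map; concat; filterᵇ; allFin; length; lookup; tabulate)
import Data.List.Membership.Propositional as Membership
open import Data.List.Membership.Propositional using (lose)
open import Data.List.Membership.Propositional.Properties using (∈-filter⁺; ∈-filter⁻; ∈-lookup; ∈-allFin)
open import Data.List.Properties
  using (map-cong; map-++; length-++; map-tabulate; tabulate-lookup; length-filter; length-tabulate)
open import Data.List.Relation.Unary.All as All using (All; []; _∷_)
import Data.List.Relation.Unary.All.Properties as All
open import Data.List.Relation.Unary.AllPairs using (AllPairs; _∷_)
import Data.List.Relation.Unary.AllPairs.Properties as AllPairs
import Data.List.Relation.Unary.Any as Any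
open import Data.List.Relation.Unary.Any.Properties using (lookup-index; any⁺; any⁻)
open import Data.Maybe using (Maybe; just; nothing; _>>=_)
import Data.Maybe.Properties as Maybe
open import Data.Nat using (ℕ; zero; suc; _+_; _*_; _∸_; _≤_; _<_; _<ᵇ_; z≤n; s≤s)
open import Data.Nat.Coprimality as Coprimality using (1-coprimeTo)
open import Data.Nat.ListAction using (sum)
open import Data.Nat.ListAction.Properties using (sum-++)
open import Data.Nat.Properties
open import Data.Nat.Tactic.RingSolver using (solve-∀)
open import Data.Product using (Σ; _×_; _,_; proj₁; proj₂; ∃-syntax)
open import Data.Rational using (ℚ; mkℚ; 0ℚ; 1ℚ)
import Data.Rational as ℚ
import Data.Rational.Properties as ℚ
import Data.Rational.Unnormalised as ℚᵘ
import Data.Rational.Unnormalised.Properties as ℚᵘ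
open import Data.Sum using (inj₁; inj₂)
import Data.Vec as Vec
open import Data.Vec.Properties using (lookup∘tabulate)
open import Function using (_∘_; id; case_of_; Equivalence)
open import Relation.Binary.Definitions using (tri<; tri≈; tri>)
open import Relation.Binary.PropositionalEquality as ≡ using (_≡_; refl; cong; cong₂; subst; trans)
open import Relation.Nullary using (Dec; yes; no)
open import Relation.Nullary.Decidable using (isYes; recompute; toWitness; fromWitness; dec-true; dec-false)
open import Relation.Nullary.Negation using (¬_; contradiction)

open CommutativeSemigroupProperties +-commutativeSemigroup using (interchange)
open CommutativeSemigroupProperties (CommutativeMonoid.commutativeSemigroup ℚ.+-0-commutativeMonoid)
  using () renaming (interchange to ℚ-interchange)
open Equivalence using (to; from)

module _ {a} {A : Set a} where

  sum-map-mono : {f g : A → ℕ} → (∀ x → f x ≤ g x) → ∀ xs → sum (map f xs) ≤ sum (map g xs)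
  sum-map-mono f≤g []       = z≤n
  sum-map-mono f≤g (x ∷ xs) = +-mono-≤ (f≤g x) (sum-map-mono f≤g xs)

  sum-map-+ : (f g : A → ℕ) → ∀ xs →
              sum (map (λ x → f x + g x) xs) ≡ sum (map f xs) + sum (map g xs)
  sum-map-+ f g []       = refl
  sum-map-+ f g (x ∷ xs) = trans (cong (f x + g x +_) (sum-map-+ f g xs)) (interchange (f x) (g x) _ _)

  sum-map-*ˡ : (c : ℕ) (f : A → ℕ) → ∀ xs → sum (map (λ x → c * f x) xs) ≡ c * sum (map f xs)
  sum-map-*ˡ c f []       = ≡.sym (*-zeroʳ c)
  sum-map-*ˡ c f (x ∷ xs) = trans (cong (c * f x +_) (sum-map-*ˡ c f xs)) (≡.sym (*-distribˡ-+ c (f x) _))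

  sum-map-cong : {f g : A → ℕ} → (∀ x → f x ≡ g x) → ∀ xs → sum (map f xs) ≡ sum (map g xs)
  sum-map-cong f≗g xs = cong sum (map-cong f≗g xs)

  sum-map-zero : {f : A → ℕ} → (∀ x → f x ≡ 0) → ∀ xs → sum (map f xs) ≡ 0
  sum-map-zero          f≗0 []       = refl
  sum-map-zero {f = f} f≗0 (x ∷ xs) = trans (cong (_+ sum (map f xs)) (f≗0 x)) (sum-map-zero f≗0 xs)

  sum-map-filterᵇ : (f : A → ℕ) (p : A → Bool) → (∀ x → p x ≡ false → f x ≡ 0) → ∀ xs →
                    sum (map f (filterᵇ p xs)) ≡ sum (map f xs)
  sum-map-filterᵇ f p f≗0 []       = refl
  sum-map-filterᵇ f p f≗0 (x ∷ xs) with p x in px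
  ... | true  = cong (f x +_) (sum-map-filterᵇ f p f≗0 xs)
  ... | false = trans (sum-map-filterᵇ f p f≗0 xs) (cong (_+ sum (map f xs)) (≡.sym (f≗0 x px)))

  sum-map-lookup : (f : A → ℕ) (xs : List A) →
                   sum (map (f ∘ lookup xs) (allFin (length xs))) ≡ sum (map f xs)
  sum-map-lookup f xs = cong sum (begin
    map (f ∘ lookup xs) (tabulate id) ≡⟨ map-tabulate id (f ∘ lookup xs) ⟩
    tabulate (f ∘ lookup xs)           ≡⟨ ≡.sym (map-tabulate (lookup xs) f) ⟩
    map f (tabulate (lookup xs))       ≡⟨ cong (map f) (tabulate-lookup xs) ⟩
    map f xs                           ∎)
    where open ≡.≡-Reasoning

  module _ {b} {B : Set b} (μ : List B → ℕ) (μ-[] : μ [] ≡ 0)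
           (μ-++ : ∀ xs ys → μ (xs ++ ys) ≡ μ xs + μ ys) where

    additive-concat-map : (h : A → List B) → ∀ xs → μ (concat (map h xs)) ≡ sum (map (μ ∘ h) xs)
    additive-concat-map h []       = μ-[]
    additive-concat-map h (x ∷ xs) = trans (μ-++ (h x) _) (cong (μ (h x) +_) (additive-concat-map h xs))

Σ² : ∀ {m} → (Fin m → Fin m → ℕ) → ℕ
Σ² {m} f = sum (map (λ i → sum (map (f i) (allFin m))) (allFin m))

module _ {m : ℕ} where

  Σ²-mono : {f g : Fin m → Fin m → ℕ} → (∀ i j → f i j ≤ g i j) → Σ² f ≤ Σ² g
  Σ²-mono f≤g = sum-map-mono (λ i → sum-map-mono (f≤g i) (allFin m)) (allFin m)

  Σ²-+ : (f g : Fin m → Fin m → ℕ) → Σ² (λ i j → f i j + g i j) ≡ Σ² f + Σ² g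
  Σ²-+ f g = trans (sum-map-cong (λ i → sum-map-+ (f i) (g i) (allFin m)) (allFin m)) (sum-map-+ _ _ (allFin m))

  Σ²-*ˡ : (c : ℕ) (f : Fin m → Fin m → ℕ) → Σ² (λ i j → c * f i j) ≡ c * Σ² f
  Σ²-*ˡ c f = trans (sum-map-cong (λ i → sum-map-*ˡ c (f i) (allFin m)) (allFin m)) (sum-map-*ˡ c _ (allFin m))

  module _ {b} {B : Set b} (μ : List B → ℕ) (μ-[] : μ [] ≡ 0)
           (μ-++ : ∀ xs ys → μ (xs ++ ys) ≡ μ xs + μ ys) where

    additive-concat² : (h : Fin m → Fin m → List B) →
                       μ (concat (map (λ i → concat (map (h i) (allFin m))) (allFin m))) ≡ Σ² (λ i j → μ (h i j))
    additive-concat² h = trans (additive-concat-map μ μ-[] μ-++ _ (allFin m))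
                               (sum-map-cong (λ i → additive-concat-map μ μ-[] μ-++ (h i) (allFin m)) (allFin m))

-- Increasing lists of vertices and induced subgraphs

<ᵇ-true : ∀ {m n} → m < n → (m <ᵇ n) ≡ true
<ᵇ-true {m} {n} = dec-true (m <? n)

<ᵇ-false : ∀ {m n} → ¬ m < n → (m <ᵇ n) ≡ false
<ᵇ-false {m} {n} = dec-false (m <? n)

Increasing : ∀ {m} → List (Fin m) → Set
Increasing = AllPairs Fin._<_

allFin-increasing : ∀ m → Increasing (allFin m)
allFin-increasing m = AllPairs.tabulate⁺-< id

lookup-increasing : ∀ {m} {xs : List (Fin m)} → Increasing xs → ∀ {i j} → i Fin.< j → lookup xs i Fin.< lookup xs j
lookup-increasing (x<ys ∷ _) {Fin.zero}  {Fin.suc j} _         = All.lookup x<ys (∈-lookup j)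
lookup-increasing (_ ∷ inc)  {Fin.suc i} {Fin.suc j} (s≤s i<j) = lookup-increasing inc i<j

module _ {m} {xs : List (Fin m)} (inc : Increasing xs) where

  lookup-injective : ∀ {i j} → lookup xs i ≡ lookup xs j → i ≡ j
  lookup-injective {i} {j} eq with <-cmp (toℕ i) (toℕ j)
  ... | tri< i<j _ _ = contradiction (cong toℕ eq) (<⇒≢ (lookup-increasing inc i<j))
  ... | tri≈ _ i≡j _ = toℕ-injective i≡j
  ... | tri> _ _ j<i = contradiction (cong toℕ (≡.sym eq)) (<⇒≢ (lookup-increasing inc j<i))

  lookup-<ᵇ : ∀ i j → (toℕ (lookup xs i) <ᵇ toℕ (lookup xs j)) ≡ (toℕ i <ᵇ toℕ j)
  lookup-<ᵇ i j with <-cmp (toℕ i) (toℕ j)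
  ... | tri< i<j _ _ = trans (<ᵇ-true (lookup-increasing inc i<j)) (≡.sym (<ᵇ-true i<j))
  ... | tri≈ _ i≡j _ rewrite toℕ-injective i≡j =
    trans (<ᵇ-false {toℕ (lookup xs j)} (<-irrefl refl)) (≡.sym (<ᵇ-false {toℕ j} (<-irrefl refl)))
  ... | tri> _ _ j<i = trans (<ᵇ-false (<-asym (lookup-increasing inc j<i))) (≡.sym (<ᵇ-false (<-asym j<i)))

symmetrise : ∀ {a} {A : Set a} {m} → (Fin m → Fin m → A) → Fin m → Fin m → A
symmetrise f u w = if toℕ u <ᵇ toℕ w then f u w else f w u

symmetrise-sym : ∀ {a} {A : Set a} {m} (f : Fin m → Fin m → A) u w → symmetrise f u w ≡ symmetrise f w u
symmetrise-sym f u w with <-cmp (toℕ u) (toℕ w)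
... | tri< u<w _ _ rewrite <ᵇ-true u<w | <ᵇ-false (<-asym u<w) = refl
... | tri≈ _ u≡w _ rewrite toℕ-injective u≡w = refl
... | tri> _ _ w<u rewrite <ᵇ-false (<-asym w<u) | <ᵇ-true w<u = refl

_∉_ : ∀ {m} → Fin m → Subset m → Set
v ∉ Z = T (not (Vec.lookup Z v))

module _ {m} (Z : Subset m) where

  private
    outside? : ∀ v → Dec (v ∉ Z)
    outside? v = T? (not (Vec.lookup Z v))

    ∈-remaining : ∀ v → .(v ∉ Z) → v Membership.∈ remaining Z
    ∈-remaining v v∉Z = ∈-filter⁺ outside? (∈-allFin v) (recompute (outside? v) v∉Z)

  remaining-increasing : Increasing (remaining Z)
  remaining-increasing = AllPairs.filter⁺ outside? (allFin-increasing m)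

  length-remaining : length (remaining Z) ≤ m
  length-remaining = ≤-trans (length-filter outside? (allFin m)) (≤-reflexive (length-tabulate id))

  lookup-remaining : ∀ i → lookup (remaining Z) i ∉ Z
  lookup-remaining i = proj₂ (∈-filter⁻ outside? {xs = allFin m} (∈-lookup {xs = remaining Z} i))

  position : ∀ v → .(v ∉ Z) → Fin (length (remaining Z))
  position v v∉Z = Any.index (∈-remaining v v∉Z)

  lookup-position : ∀ v .(v∉Z : v ∉ Z) → lookup (remaining Z) (position v v∉Z) ≡ v
  lookup-position v v∉Z = ≡.sym (lookup-index (∈-remaining v v∉Z))

  position-lookup : ∀ i → position (lookup (remaining Z) i) (lookup-remaining i) ≡ i
  position-lookup i = lookup-injective remaining-increasing (lookup-position _ (lookup-remaining i))

  toRemaining : Fin m → Maybe (Fin (length (remaining Z)))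
  toRemaining v with T? (not (Vec.lookup Z v))
  ... | yes v∉Z = just (position v v∉Z)
  ... | no  _   = nothing

  toRemaining-lookup : ∀ i → toRemaining (lookup (remaining Z) i) ≡ just i
  toRemaining-lookup i with T? (not (Vec.lookup Z (lookup (remaining Z) i)))
  ... | yes _   = cong just (position-lookup i)
  ... | no  v∈Z = contradiction (lookup-remaining i) v∈Z

edgeIndicator : (K : Graph) → Fin (n K) → Fin (n K) → ℕ
edgeIndicator K i j = if (toℕ i <ᵇ toℕ j) ∧ adj K i j then 1 else 0

edgeIndicator-absent : (K : Graph) → ∀ {i j} → adj K i j ≡ false → edgeIndicator K i j ≡ 0
edgeIndicator-absent K {i} {j} i≁j rewrite i≁j | ∧-zeroʳ (toℕ i <ᵇ toℕ j) = refl

∣E∣-∖-isolated : (K : Graph) (Z : Subset (n K)) →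
                 (∀ i j → Vec.lookup Z i ≡ true → adj K i j ≡ false) → ∣E∣ (K ∖ Z) ≡ ∣E∣ K
∣E∣-∖-isolated K Z isolated = begin
  sum (map (λ a → sum (map (edgeIndicator (K ∖ Z) a) (allFin len))) (allFin len))
    ≡⟨ sum-map-cong (λ a → sum-map-cong (λ b → cong (λ t → if t ∧ adj K (emb a) (emb b) then 1 else 0)
                                                     (≡.sym (lookup-<ᵇ (remaining-increasing Z) a b)))
                                         (allFin len))
                    (allFin len) ⟩
  sum (map (λ a → sum (map (edgeIndicator K (emb a) ∘ emb) (allFin len))) (allFin len))
    ≡⟨ sum-map-cong (λ a → sum-map-lookup (edgeIndicator K (emb a)) (remaining Z)) (allFin len) ⟩
  sum (map (λ a → sum (map (edgeIndicator K (emb a)) (remaining Z))) (allFin len))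
    ≡⟨ sum-map-cong (λ a → sum-map-filterᵇ (edgeIndicator K (emb a)) outside
                             (λ j j∈Z → edgeIndicator-absent K (trans (sym K (emb a) j) (isolated j (emb a) (inside j∈Z))))
                             (allFin (n K)))
                    (allFin len) ⟩
  sum (map (row ∘ emb) (allFin len))
    ≡⟨ sum-map-lookup row (remaining Z) ⟩
  sum (map row (remaining Z))
    ≡⟨ sum-map-filterᵇ row outside (λ i i∈Z → sum-map-zero (λ j → edgeIndicator-absent K (isolated i j (inside i∈Z))) (allFin (n K))) (allFin (n K)) ⟩
  ∣E∣ K ∎
  where
  open ≡.≡-Reasoning
  len = length (remaining Z)
  emb = lookup (remaining Z)
  outside : Fin (n K) → Bool
  outside v = not (Vec.lookup Z v)
  inside : ∀ {v} → outside v ≡ false → Vec.lookup Z v ≡ true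
  inside = not-injective
  row : Fin (n K) → ℕ
  row i = sum (map (edgeIndicator K i) (allFin (n K)))

module _ {K : Graph} {P : Fin (n K) → Set} where

  walkVertices : ∀ {u v ℓ} → WalkIn K P u v ℓ → List (Fin (n K))
  walkVertices (here {v} _)     = v ∷ []
  walkVertices (step {u} _ _ W) = u ∷ walkVertices W

  length-walkVertices : ∀ {u v ℓ} (W : WalkIn K P u v ℓ) → length (walkVertices W) ≡ suc ℓ
  length-walkVertices (here _)     = refl
  length-walkVertices (step _ _ W) = cong suc (length-walkVertices W)

  walk-start : ∀ {u v ℓ} → WalkIn K P u v ℓ → P u
  walk-start (here pv)     = pv
  walk-start (step pu _ _) = pu

  walk-∷ʳ : ∀ {u w v ℓ} → WalkIn K P u w ℓ → P v → adj K w v ≡ true → WalkIn K P u v (suc ℓ)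
  walk-∷ʳ (here pw)      pv w~v = step pw w~v (here pv)
  walk-∷ʳ (step pu e W)  pv w~v = step pu e (walk-∷ʳ W pv w~v)

  walk-map : ∀ {Q : Fin (n K) → Set} {u v ℓ} → (∀ {x} → P x → Q x) → WalkIn K P u v ℓ → WalkIn K Q u v ℓ
  walk-map P⇒Q (here pv)     = here (P⇒Q pv)
  walk-map P⇒Q (step pu e W) = step (P⇒Q pu) e (walk-map P⇒Q W)

  module _ {Q : Fin (n K) → Set} where

    All-walk-start : ∀ {u v ℓ} (W : WalkIn K P u v ℓ) → All Q (walkVertices W) → Q u
    All-walk-start (here _)     (qv ∷ _) = qv
    All-walk-start (step _ _ _) (qu ∷ _) = qu

    All-walk-end : ∀ {u v ℓ} (W : WalkIn K P u v ℓ) → All Q (walkVertices W) → Q v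
    All-walk-end (here _)     (qv ∷ _)  = qv
    All-walk-end (step _ _ W) (_ ∷ qW) = All-walk-end W qW

  walk-∖ : ∀ (X : Subset (n K)) {u v ℓ} (W : WalkIn K P u v ℓ) (W∉X : All (_∉ X) (walkVertices W)) →
           WalkIn (K ∖ X) (P ∘ lookup (remaining X))
                  (position X u (All-walk-start W W∉X)) (position X v (All-walk-end W W∉X)) ℓ
  walk-∖ X (here pv) (v∉X ∷ []) = here (subst P (≡.sym (lookup-position X _ v∉X)) pv)
  walk-∖ X (step pu u~w W) (u∉X ∷ W∉X) =
    step (subst P (≡.sym (lookup-position X _ u∉X)) pu)
         (trans (cong₂ (adj K) (lookup-position X _ u∉X) (lookup-position X _ (All-walk-start W W∉X))) u~w)
         (walk-∖ X W W∉X)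

avoids : ∀ {m} → Subset m → List (Fin m) → Bool
avoids Z = all (λ v → not (Vec.lookup Z v))

hits : ∀ {m} → Subset m → List (Fin m) → ℕ
hits Z = sum ∘ map (λ v → if Vec.lookup Z v then 1 else 0)

hits-++ : ∀ {m} (Z : Subset m) xs ys → hits Z (xs ++ ys) ≡ hits Z xs + hits Z ys
hits-++ Z xs ys = trans (cong sum (map-++ _ xs ys)) (sum-++ (map _ xs) _)

hits-positive : ∀ {m} (Z : Subset m) xs → ¬ T (avoids Z xs) → 1 ≤ hits Z xs
hits-positive Z []       hit = contradiction _ hit
hits-positive Z (v ∷ xs) hit with Vec.lookup Z v
... | true  = s≤s z≤n
... | false = ≤-trans (hits-positive Z xs hit) (m≤n+m _ 0)

indicator-∧-≤ : ∀ a b {h} → (T a → ¬ T b → 1 ≤ h) → (if a then 1 else 0) ≤ (if a ∧ b then 1 else 0) + h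
indicator-∧-≤ false _     _    = z≤n
indicator-∧-≤ true  true  _    = s≤s z≤n
indicator-∧-≤ true  false miss = miss _ (λ ())

-- Bounded reachability

module Reachability (K : Graph) {P : Fin (n K) → Set} (P? : ∀ x → Dec (P x)) (c : Fin (n K)) where

  reach : ℕ → Fin (n K) → Bool
  reach zero    a = isYes (P? a) ∧ isYes (a Fin.≟ c)
  reach (suc l) a = reach l a ∨ (isYes (P? a) ∧ any (λ b → reach l b ∧ adj K b a) (allFin (n K)))

  reach-suc : ∀ {l a} → T (reach l a) → T (reach (suc l) a)
  reach-suc {l} {a} r = from (T-∨ {reach l a}) (inj₁ r)

  reach-mono : ∀ {l l′ a} → l ≤ l′ → T (reach l a) → T (reach l′ a)
  reach-mono {l} {l′} {a} l≤l′ r = subst (λ j → T (reach j a)) (m∸n+n≡m l≤l′) (lift (l′ ∸ l) r)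
    where
    lift : ∀ d → T (reach l a) → T (reach (d + l) a)
    lift zero    r = r
    lift (suc d) r = reach-suc {d + l} (lift d r)

  reach⇒P : ∀ l {a} → T (reach l a) → P a
  reach⇒P zero    {a} r = toWitness {a? = P? a} (proj₁ (to (T-∧ {isYes (P? a)}) r))
  reach⇒P (suc l) {a} r with to (T-∨ {reach l a}) r
  ... | inj₁ r′ = reach⇒P l r′
  ... | inj₂ r′ = toWitness {a? = P? a} (proj₁ (to (T-∧ {isYes (P? a)}) r′))

  reach-centre : P c → T (reach 0 c)
  reach-centre pc = from T-∧ (fromWitness {a? = P? c} pc , fromWitness {a? = c Fin.≟ c} refl)

  reach-sound : ∀ l {a} → T (reach l a) → ∃[ m ] (m ≤ l × WalkIn K (T ∘ reach l) c a m)
  reach-sound zero {a} r with toWitness {a? = a Fin.≟ c} (proj₂ (to T-∧ r))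
  ... | refl = 0 , z≤n , here r
  reach-sound (suc l) {a} r with to T-∨ r
  ... | inj₁ r′ = let m , m≤l , W = reach-sound l r′ in m , m≤n⇒m≤1+n m≤l , walk-map (reach-suc {l}) W
  ... | inj₂ r′ =
    let _ , some-pred = to (T-∧ {isYes (P? a)}) r′
        b , rb∧b~a    = Any.satisfied (any⁻ (λ b → reach l b ∧ adj K b a) (allFin (n K)) some-pred)
        rb , b~a      = to (T-∧ {reach l b}) rb∧b~a
        m , m≤l , W   = reach-sound l rb
    in suc m , s≤s m≤l , walk-∷ʳ (walk-map (reach-suc {l}) W) r (to T-≡ b~a)

  reach-complete : ∀ {s a m} → WalkIn K P s a m → ∀ l → T (reach l s) → T (reach (l + m) a)
  reach-complete {a = a} (here _) l r = subst (λ j → T (reach j a)) (≡.sym (+-identityʳ l)) r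
  reach-complete {s} {a} {suc m} (step {w = w} _ s~w W) l r =
    subst (λ j → T (reach j a)) (≡.sym (+-suc l m)) (reach-complete W (suc l) r-next)
    where
    r-next : T (reach (suc l) w)
    r-next = from (T-∨ {reach l w}) (inj₂ (from (T-∧ {isYes (P? w)}) (fromWitness {a? = P? w} (walk-start W) ,
               any⁺ (λ b → reach l b ∧ adj K b w) (lose (∈-allFin s) (from T-∧ (r , from T-≡ s~w))))))

-- Deleting a vertex set from a minor

module MinorDeletion {G H : Graph} {k : ℕ} (M : H IsMinorAtDepth k Of G) where

  open _IsMinorAtDepth_Of_ M

  Branch : Fin (n H) → Fin (n G) → Set
  Branch u x = φ x ≡ just u

  record EdgeRealisation (u w : Fin (n H)) : Set where
    field
      {x y}   : Fin (n G)
      {ℓˣ ℓʸ} : ℕ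
      x~y   : adj G x y ≡ true
      ℓˣ≤k  : ℓˣ ≤ k
      ℓʸ≤k  : ℓʸ ≤ k
      walkˣ : WalkIn G (Branch u) (centre u) x ℓˣ
      walkʸ : WalkIn G (Branch w) (centre w) y ℓʸ

    vertices : List (Fin (n G))
    vertices = walkVertices walkˣ ++ walkVertices walkʸ

    length-vertices : length vertices ≤ suc k + suc k
    length-vertices = begin
      length vertices                                       ≡⟨ length-++ (walkVertices walkˣ) ⟩
      length (walkVertices walkˣ) + length (walkVertices walkʸ) ≡⟨ cong₂ _+_ (length-walkVertices walkˣ) (length-walkVertices walkʸ) ⟩
      suc ℓˣ + suc ℓʸ                                       ≤⟨ +-mono-≤ (s≤s ℓˣ≤k) (s≤s ℓʸ≤k) ⟩
      suc k + suc k                                         ∎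
      where open ≤-Reasoning

  realise : ∀ {u w} → adj H u w ≡ true → EdgeRealisation u w
  realise {u} {w} u~w =
    let x , y , x∈u , y∈w , x~y = edges u w u~w
        _ , ℓˣ≤k , walkˣ = radius u x x∈u
        _ , ℓʸ≤k , walkʸ = radius w y y∈w
    in record { x~y = x~y ; ℓˣ≤k = ℓˣ≤k ; ℓʸ≤k = ℓʸ≤k ; walkˣ = walkˣ ; walkʸ = walkʸ }

  witness : Fin (n H) → Fin (n H) → List (Fin (n G))
  witness u w with adj H u w Bool.≟ true
  ... | yes u~w = EdgeRealisation.vertices (realise u~w)
  ... | no  _   = []

  length-witness : ∀ u w → length (witness u w) ≤ (suc k + suc k) * (if adj H u w then 1 else 0)
  length-witness u w with adj H u w Bool.≟ true
  ... | yes u~w = subst (λ b → length (EdgeRealisation.vertices (realise u~w)) ≤ (suc k + suc k) * (if b then 1 else 0)) (≡.sym u~w)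
                        (≤-trans (EdgeRealisation.length-vertices (realise u~w)) (≤-reflexive (≡.sym (*-identityʳ _))))
  ... | no  _   = z≤n

  witness-avoids : ∀ X {u w} → adj H u w ≡ true → T (avoids X (witness u w)) →
                   Σ (EdgeRealisation u w) λ r → All (_∉ X) (walkVertices (EdgeRealisation.walkˣ r))
                                               × All (_∉ X) (walkVertices (EdgeRealisation.walkʸ r))
  witness-avoids X {u} {w} u~w avoid with adj H u w Bool.≟ true
  ... | yes u~w′ = realise u~w′ , All.++⁻ _ (All.all⁺ _ _ avoid)
  ... | no  u≁w  = contradiction u~w u≁w

  orderedWitness : Fin (n H) → Fin (n H) → List (Fin (n G))
  orderedWitness i j = if toℕ i <ᵇ toℕ j then witness i j else []

  edgeWitnesses : List (Fin (n G))
  edgeWitnesses = concat (map (λ i → concat (map (orderedWitness i) (allFin (n H)))) (allFin (n H)))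

  length-edgeWitnesses : length edgeWitnesses ≤ (suc k + suc k) * ∣E∣ H
  length-edgeWitnesses = begin
    length edgeWitnesses                               ≡⟨ additive-concat² length refl (λ xs _ → length-++ xs) orderedWitness ⟩
    Σ² (λ i j → length (orderedWitness i j))           ≤⟨ Σ²-mono length-orderedWitness ⟩
    Σ² (λ i j → (suc k + suc k) * edgeIndicator H i j) ≡⟨ Σ²-*ˡ (suc k + suc k) (edgeIndicator H) ⟩
    (suc k + suc k) * ∣E∣ H                            ∎
    where
    open ≤-Reasoning
    length-orderedWitness : ∀ i j → length (orderedWitness i j) ≤ (suc k + suc k) * edgeIndicator H i j
    length-orderedWitness i j with toℕ i <ᵇ toℕ j
    ... | true  = length-witness i j
    ... | false = z≤n

  module _ (X : Subset (n G)) where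

    witnessAvoids : Fin (n H) → Fin (n H) → Bool
    witnessAvoids u w = avoids X (witness u w)

    -- An edge keeps only the witness of its increasingly ordered pair, so that edgeWitnesses
    -- spends 2(k+1) vertices per edge of H.
    intact : Fin (n H) → Fin (n H) → Bool
    intact = symmetrise witnessAvoids

    pruned : Graph
    pruned = record
      { n      = n H
      ; adj    = λ u w → adj H u w ∧ intact u w
      ; sym    = λ u w → cong₂ _∧_ (sym H u w) (symmetrise-sym witnessAvoids u w)
      ; irrefl = λ u → cong (_∧ intact u u) (irrefl H u)
      }

    ∣E∣-≤-pruned+hits : ∣E∣ H ≤ ∣E∣ pruned + hits X edgeWitnesses
    ∣E∣-≤-pruned+hits = begin
      Σ² (edgeIndicator H)                                                ≤⟨ Σ²-mono edgeIndicator-≤ ⟩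
      Σ² (λ i j → edgeIndicator pruned i j + hits X (orderedWitness i j)) ≡⟨ Σ²-+ (edgeIndicator pruned) _ ⟩
      ∣E∣ pruned + Σ² (λ i j → hits X (orderedWitness i j))               ≡⟨ cong (∣E∣ pruned +_) (≡.sym (additive-concat² (hits X) refl (hits-++ X) orderedWitness)) ⟩
      ∣E∣ pruned + hits X edgeWitnesses                                   ∎
      where
      open ≤-Reasoning
      edgeIndicator-≤ : ∀ i j → edgeIndicator H i j ≤ edgeIndicator pruned i j + hits X (orderedWitness i j)
      edgeIndicator-≤ i j with toℕ i <ᵇ toℕ j
      ... | true  = indicator-∧-≤ (adj H i j) (avoids X (witness i j)) (λ _ → hits-positive X (witness i j))
      ... | false = z≤n

    lost : Subset (n H)
    lost = Vec.tabulate (λ u → Vec.lookup X (centre u))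

    intact⇒centre∉X : ∀ {u w} → adj H u w ≡ true → T (intact u w) → centre u ∉ X
    intact⇒centre∉X {u} {w} u~w ok with toℕ u <ᵇ toℕ w
    ... | true  = let r , ˣ∉X , _ = witness-avoids X u~w ok
                  in All-walk-start (EdgeRealisation.walkˣ r) ˣ∉X
    ... | false = let r , _ , ʸ∉X = witness-avoids X (trans (sym H w u) u~w) ok
                  in All-walk-start (EdgeRealisation.walkʸ r) ʸ∉X

    lost-isolated : ∀ u w → Vec.lookup lost u ≡ true → adj pruned u w ≡ false
    lost-isolated u w u∈lost with intact u w in ok
    ... | false = ∧-zeroʳ (adj H u w)
    ... | true = by-adjacency (adj H u w Bool.≟ true)
      where
      by-adjacency : Dec (adj H u w ≡ true) → adj H u w ∧ true ≡ false
      by-adjacency (yes u~w) = ⊥-elim (subst (T ∘ not) centre∈X (intact⇒centre∉X u~w (from T-≡ ok)))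
        where centre∈X = trans (≡.sym (lookup∘tabulate _ u)) u∈lost
      by-adjacency (no u≁w)  = trans (∧-identityʳ (adj H u w)) (¬-not u≁w)

    private
      G′ H′ : Graph
      G′ = G ∖ X
      H′ = pruned ∖ lost
      embG : Fin (n G′) → Fin (n G)
      embG = lookup (remaining X)
      embH : Fin (n H′) → Fin (n H)
      embH = lookup (remaining lost)

    centre∉X : ∀ u′ → centre (embH u′) ∉ X
    centre∉X u′ = subst (T ∘ not) (lookup∘tabulate _ (embH u′)) (lookup-remaining lost u′)

    centre′ : Fin (n H′) → Fin (n G′)
    centre′ u′ = position X (centre (embH u′)) (centre∉X u′)

    centre′-branch : ∀ u′ → Branch (embH u′) (embG (centre′ u′))
    centre′-branch u′ = trans (cong φ (lookup-position X _ (centre∉X u′))) (centreIn (embH u′))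

    module R (u′ : Fin (n H′)) =
      Reachability G′ (λ a → Maybe.≡-dec Fin._≟_ (φ (embG a)) (just (embH u′))) (centre′ u′)

    -- The new branch set of u′ is the part of the old one reachable from its centre within k steps in G − X.
    φ′ : Fin (n G′) → Maybe (Fin (n H′))
    φ′ a = φ (embG a) >>= toRemaining lost >>= λ u′ → if R.reach u′ k a then just u′ else nothing

    φ′-intro : ∀ {u′ a} → T (R.reach u′ k a) → φ′ a ≡ just u′
    φ′-intro {u′} r rewrite R.reach⇒P u′ k r | toRemaining-lookup lost u′ | to T-≡ r = refl

    φ′-reach : ∀ {u′ a} → φ′ a ≡ just u′ → T (R.reach u′ k a)
    φ′-reach {u′} {a} eq with φ (embG a)
    ... | nothing = case eq of λ ()
    ... | just u with toRemaining lost u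
    ...   | nothing = case eq of λ ()
    ...   | just v with R.reach v k a in r
    ...     | false = case eq of λ ()
    ...     | true with refl ← eq = from T-≡ r

    walk-reaches : ∀ u′ {x ℓ} (W : WalkIn G (Branch (embH u′)) (centre (embH u′)) x ℓ)
                   (W∉X : All (_∉ X) (walkVertices W)) → ℓ ≤ k →
                   φ′ (position X x (All-walk-end W W∉X)) ≡ just u′
    walk-reaches u′ W W∉X ℓ≤k = φ′-intro (R.reach-mono u′ ℓ≤k
      (R.reach-complete u′ (walk-∖ X W W∉X) 0 (R.reach-centre u′ (centre′-branch u′))))

    EdgeIn : Fin (n H′) → Fin (n H′) → Set
    EdgeIn u′ w′ = ∃[ x′ ] ∃[ y′ ] (φ′ x′ ≡ just u′ × φ′ y′ ≡ just w′ × adj G′ x′ y′ ≡ true)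

    realised-edge : ∀ u′ w′ → adj H (embH u′) (embH w′) ≡ true → T (witnessAvoids (embH u′) (embH w′)) →
                    EdgeIn u′ w′
    realised-edge u′ w′ u~w avoid =
      _ , _ , walk-reaches u′ walkˣ ˣ∉X ℓˣ≤k , walk-reaches w′ walkʸ ʸ∉X ℓʸ≤k ,
      trans (cong₂ (adj G) (lookup-position X _ (All-walk-end walkˣ ˣ∉X))
                           (lookup-position X _ (All-walk-end walkʸ ʸ∉X))) x~y
      where
      realisation = witness-avoids X u~w avoid
      open EdgeRealisation (proj₁ realisation)
      ˣ∉X = proj₁ (proj₂ realisation)
      ʸ∉X = proj₂ (proj₂ realisation)

    edges′ : ∀ u′ w′ → adj H′ u′ w′ ≡ true → EdgeIn u′ w′
    edges′ u′ w′ u′~w′ = by-order (∧-conicalˡ _ _ u′~w′) (from T-≡ (∧-conicalʳ _ _ u′~w′))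
      where
      by-order : adj H (embH u′) (embH w′) ≡ true → T (intact (embH u′) (embH w′)) → EdgeIn u′ w′
      by-order u~w ok with toℕ (embH u′) <ᵇ toℕ (embH w′)
      ... | true  = realised-edge u′ w′ u~w ok
      ... | false = let y′ , x′ , y∈w , x∈u , y~x = realised-edge w′ u′ (trans (sym H _ _) u~w) ok
                    in x′ , y′ , x∈u , y∈w , trans (sym G′ x′ y′) y~x

    prunedMinor : H′ IsMinorAtDepth k Of G′
    prunedMinor = record
      { φ        = φ′
      ; centre   = centre′
      ; centreIn = λ u′ → φ′-intro (R.reach-mono u′ {l′ = k} z≤n (R.reach-centre u′ (centre′-branch u′)))
      ; radius   = λ u′ _ a∈u′ → let m , m≤k , W = R.reach-sound u′ k (φ′-reach a∈u′)
                                 in m , m≤k , walk-map φ′-intro W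
      ; edges    = edges′
      }

    ∣E∣-bound : ∀ {h} → Ex h (G ∖ X) → ∣E∣ H ≤ h k * ∣V∣ H + hits X edgeWitnesses
    ∣E∣-bound {h} ex = ≤-trans ∣E∣-≤-pruned+hits (+-monoˡ-≤ (hits X edgeWitnesses) (begin
      ∣E∣ pruned    ≡⟨ ≡.sym (∣E∣-∖-isolated pruned lost lost-isolated) ⟩
      ∣E∣ H′        ≤⟨ ex k H′ prunedMinor ⟩
      h k * ∣V∣ H′  ≤⟨ *-monoʳ-≤ (h k) (length-remaining lost) ⟩
      h k * ∣V∣ H   ∎))
      where open ≤-Reasoning

-- Averaging over a fractional packing

fromℕ : ℕ → ℚ
fromℕ m = mkℚ (ℤ.+ m) 0 (Coprimality.sym (1-coprimeTo m))

fromℕ-+ : ∀ a b → fromℕ (a + b) ≡ fromℕ a ℚ.+ fromℕ b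
fromℕ-+ a b = ℚ.toℚᵘ-injective (ℚᵘ.≃-trans (ℚᵘ.*≡* cross) (ℚᵘ.≃-sym (ℚ.toℚᵘ-homo-+ (fromℕ a) (fromℕ b))))
  where
  cross : ℤ.+ (a + b) ℤ.* ℤ.+ 1 ≡ (ℤ.+ a ℤ.* ℤ.+ 1 ℤ.+ ℤ.+ b ℤ.* ℤ.+ 1) ℤ.* ℤ.+ 1
  cross rewrite ℤ.*-identityʳ (ℤ.+ (a + b)) | ℤ.*-identityʳ (ℤ.+ a) | ℤ.*-identityʳ (ℤ.+ b)
              | ℤ.*-identityʳ (ℤ.+ a ℤ.+ ℤ.+ b) = ℤ.pos-+ a b

fromℕ-* : ∀ a b → fromℕ (a * b) ≡ fromℕ a ℚ.* fromℕ b
fromℕ-* a b = ℚ.toℚᵘ-injective (ℚᵘ.≃-trans (ℚᵘ.*≡* cross) (ℚᵘ.≃-sym (ℚ.toℚᵘ-homo-* (fromℕ a) (fromℕ b))))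
  where
  cross : ℤ.+ (a * b) ℤ.* ℤ.+ 1 ≡ (ℤ.+ a ℤ.* ℤ.+ b) ℤ.* ℤ.+ 1
  cross rewrite ℤ.*-identityʳ (ℤ.+ (a * b)) | ℤ.*-identityʳ (ℤ.+ a ℤ.* ℤ.+ b) = ℤ.pos-* a b

fromℕ-mono-≤ : ∀ {a b} → a ≤ b → fromℕ a ℚ.≤ fromℕ b
fromℕ-mono-≤ a≤b = ℚ.*≤* (ℤ.*-monoʳ-≤-nonNeg (ℤ.+ 1) (ℤ.+≤+ a≤b))

fromℕ-cancel-≤ : ∀ {a b} → fromℕ a ℚ.≤ fromℕ b → a ≤ b
fromℕ-cancel-≤ {a} {b} (ℚ.*≤* a≤b) = ℤ.drop‿+≤+ (ℤ.*-cancelʳ-≤-pos (ℤ.+ a) (ℤ.+ b) (ℤ.+ 1) a≤b)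

1/suc-inverse : ∀ m .(c : Coprimality.Coprime 1 (suc m)) → mkℚ (ℤ.+ 1) m c ℚ.* fromℕ (suc m) ≡ 1ℚ
1/suc-inverse m c = ℚ.toℚᵘ-injective (ℚᵘ.≃-trans (ℚ.toℚᵘ-homo-* (mkℚ (ℤ.+ 1) m c) (fromℕ (suc m))) (ℚᵘ.*≡* cross))
  where
  cross : (ℤ.+ 1 ℤ.* ℤ.+ suc m) ℤ.* ℤ.+ 1 ≡ ℤ.+ 1 ℤ.* ℤ.+ (suc m * 1)
  cross rewrite ℤ.*-identityʳ (ℤ.+ 1 ℤ.* ℤ.+ suc m) | ℤ.*-identityˡ (ℤ.+ suc m) | *-identityʳ m | +-identityʳ m = refl

inv4k4-inverse : ∀ k → val (inv4k4 k) ℚ.* fromℕ (suc (4 * k + 3)) ≡ 1ℚ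
inv4k4-inverse k = trans (cong (ℚ._* fromℕ (suc m)) (ℚ.normalize-coprime {1} {m} (1-coprimeTo (suc m))))
                         (1/suc-inverse m (1-coprimeTo (suc m)))
  where m = 4 * k + 3

module _ {a} {A : Set a} where

  ℚsum-map-*ʳ : (f : A → ℚ) (c : ℚ) → ∀ xs → ℚsum (map (λ x → f x ℚ.* c) xs) ≡ ℚsum (map f xs) ℚ.* c
  ℚsum-map-*ʳ f c []       = ≡.sym (ℚ.*-zeroˡ c)
  ℚsum-map-*ʳ f c (x ∷ xs) = trans (cong (f x ℚ.* c ℚ.+_) (ℚsum-map-*ʳ f c xs)) (≡.sym (ℚ.*-distribʳ-+ c (f x) _))

  ℚsum-map-+ : (f g : A → ℚ) → ∀ xs → ℚsum (map (λ x → f x ℚ.+ g x) xs) ≡ ℚsum (map f xs) ℚ.+ ℚsum (map g xs)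
  ℚsum-map-+ f g []       = ≡.sym (ℚ.+-identityˡ 0ℚ)
  ℚsum-map-+ f g (x ∷ xs) = trans (cong (f x ℚ.+ g x ℚ.+_) (ℚsum-map-+ f g xs)) (ℚ-interchange (f x) (g x) _ _)

  ℚsum-map-mono : {f g : A → ℚ} → (∀ x → f x ℚ.≤ g x) → ∀ xs → ℚsum (map f xs) ℚ.≤ ℚsum (map g xs)
  ℚsum-map-mono f≤g []       = ℚ.≤-refl
  ℚsum-map-mono f≤g (x ∷ xs) = ℚ.+-mono-≤ (f≤g x) (ℚsum-map-mono f≤g xs)

  ℚsum-map-indicator : (f : A → ℚ) (p : A → Bool) → ∀ xs →
                       ℚsum (map (λ x → f x ℚ.* fromℕ (if p x then 1 else 0)) xs) ≡ ℚsum (map f (filterᵇ p xs))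
  ℚsum-map-indicator f p []       = refl
  ℚsum-map-indicator f p (x ∷ xs) with p x
  ... | true  = cong₂ ℚ._+_ (ℚ.*-identityʳ (f x)) (ℚsum-map-indicator f p xs)
  ... | false = trans (cong (ℚ._+ _) (ℚ.*-zeroʳ (f x))) (trans (ℚ.+-identityˡ _) (ℚsum-map-indicator f p xs))

module _ {𝒞 : GraphClass} {G : Graph} {ε : ℚ} (packing : FracPacking 𝒞 G ε) where

  open FracPacking packing

  average : (Subset (n G) → ℕ) → ℚ
  average f = ℚsum (map (λ X → π X ℚ.* fromℕ (f X)) (allSubsets (n G)))

  average-const : ∀ c → average (λ _ → c) ≡ fromℕ c
  average-const c = begin
    ℚsum (map (λ X → π X ℚ.* fromℕ c) (allSubsets (n G))) ≡⟨ ℚsum-map-*ʳ π (fromℕ c) (allSubsets (n G)) ⟩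
    ℚsum (map π (allSubsets (n G))) ℚ.* fromℕ c           ≡⟨ cong (ℚ._* fromℕ c) total ⟩
    1ℚ ℚ.* fromℕ c                                        ≡⟨ ℚ.*-identityˡ (fromℕ c) ⟩
    fromℕ c                                               ∎
    where open ≡.≡-Reasoning

  average-+ : ∀ f g → average (λ X → f X + g X) ≡ average f ℚ.+ average g
  average-+ f g = trans (cong ℚsum (map-cong split (allSubsets (n G))))
                        (ℚsum-map-+ (λ X → π X ℚ.* fromℕ (f X)) (λ X → π X ℚ.* fromℕ (g X)) (allSubsets (n G)))
    where
    split : ∀ X → π X ℚ.* fromℕ (f X + g X) ≡ π X ℚ.* fromℕ (f X) ℚ.+ π X ℚ.* fromℕ (g X)
    split X = trans (cong (π X ℚ.*_) (fromℕ-+ (f X) (g X))) (ℚ.*-distribˡ-+ (π X) _ _)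

  ≤-average : ∀ {f} b → (∀ X → 0ℚ ℚ.< π X → b ≤ f X) → fromℕ b ℚ.≤ average f
  ≤-average {f} b b≤f = subst (ℚ._≤ average f) (average-const b) (ℚsum-map-mono weighted-≤ (allSubsets (n G)))
    where
    weighted-≤ : ∀ X → π X ℚ.* fromℕ b ℚ.≤ π X ℚ.* fromℕ (f X)
    weighted-≤ X with 0ℚ ℚ.<? π X
    ... | yes πX>0 = ℚ.*-monoˡ-≤-nonNeg (π X) {{ℚ.nonNegative (nonneg X)}} (fromℕ-mono-≤ (b≤f X πX>0))
    ... | no  πX≯0 rewrite ℚ.≤-antisym (ℚ.≮⇒≥ πX≯0) (nonneg X) =
      ℚ.≤-reflexive (trans (ℚ.*-zeroˡ (fromℕ b)) (≡.sym (ℚ.*-zeroˡ (fromℕ (f X)))))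

  average-hits : ∀ L → average (λ X → hits X L) ℚ.≤ ε ℚ.* fromℕ (length L)
  average-hits []      = ℚ.≤-reflexive (trans (average-const 0) (≡.sym (ℚ.*-zeroʳ ε)))
  average-hits (v ∷ L) = begin
    average (λ X → hits X (v ∷ L))                 ≡⟨ average-+ (λ X → if Vec.lookup X v then 1 else 0) (λ X → hits X L) ⟩
    average (λ X → if Vec.lookup X v then 1 else 0) ℚ.+ average (λ X → hits X L)
      ≤⟨ ℚ.+-mono-≤ (ℚ.≤-reflexive (ℚsum-map-indicator π (λ X → Vec.lookup X v) (allSubsets (n G)))) (average-hits L) ⟩
    ℚsum (map π (filterᵇ (λ X → Vec.lookup X v) (allSubsets (n G)))) ℚ.+ ε ℚ.* fromℕ (length L)
      ≤⟨ ℚ.+-monoˡ-≤ (ε ℚ.* fromℕ (length L)) (thickness v) ⟩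
    ε ℚ.+ ε ℚ.* fromℕ (length L)                   ≡⟨ cong (ℚ._+ ε ℚ.* fromℕ (length L)) (≡.sym (ℚ.*-identityʳ ε)) ⟩
    ε ℚ.* 1ℚ ℚ.+ ε ℚ.* fromℕ (length L)            ≡⟨ ≡.sym (ℚ.*-distribˡ-+ ε 1ℚ (fromℕ (length L))) ⟩
    ε ℚ.* (1ℚ ℚ.+ fromℕ (length L))                ≡⟨ cong (ε ℚ.*_) (≡.sym (fromℕ-+ 1 (length L))) ⟩
    ε ℚ.* fromℕ (suc (length L))                   ∎
    where open ℚ.≤-Reasoning

∣E∣-≤-via-packing : ∀ {h G H k ε} → 0ℚ ℚ.≤ ε → FracPacking (Ex h) G ε → H IsMinorAtDepth k Of G →
                    fromℕ (∣E∣ H) ℚ.≤ fromℕ (h k * ∣V∣ H) ℚ.+ ε ℚ.* fromℕ ((suc k + suc k) * ∣E∣ H)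
∣E∣-≤-via-packing {h} {H = H} {k} {ε} ε≥0 packing M = begin
  fromℕ (∣E∣ H)
    ≤⟨ ≤-average packing (∣E∣ H) (λ X πX>0 → ∣E∣-bound X {h} (support X πX>0)) ⟩
  average packing (λ X → h k * ∣V∣ H + hits X edgeWitnesses)
    ≡⟨ average-+ packing (λ _ → h k * ∣V∣ H) (λ X → hits X edgeWitnesses) ⟩
  average packing (λ _ → h k * ∣V∣ H) ℚ.+ average packing (λ X → hits X edgeWitnesses)
    ≤⟨ ℚ.+-mono-≤ (ℚ.≤-reflexive (average-const packing (h k * ∣V∣ H))) (average-hits packing edgeWitnesses) ⟩
  fromℕ (h k * ∣V∣ H) ℚ.+ ε ℚ.* fromℕ (length edgeWitnesses)
    ≤⟨ ℚ.+-monoʳ-≤ (fromℕ (h k * ∣V∣ H))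
         (ℚ.*-monoˡ-≤-nonNeg ε {{ℚ.nonNegative ε≥0}} (fromℕ-mono-≤ length-edgeWitnesses)) ⟩
  fromℕ (h k * ∣V∣ H) ℚ.+ ε ℚ.* fromℕ ((suc k + suc k) * ∣E∣ H) ∎
  where
  open ℚ.≤-Reasoning
  open FracPacking packing using (support)
  open MinorDeletion M

private
  twice-2k+2≡4k+4 : ∀ k E → (suc k + suc k) * E + (suc k + suc k) * E ≡ suc (4 * k + 3) * E
  twice-2k+2≡4k+4 = solve-∀

absorb-half : ∀ k {E B} → fromℕ E ℚ.≤ fromℕ B ℚ.+ val (inv4k4 k) ℚ.* fromℕ ((suc k + suc k) * E) →
              E ≤ 2 * B
absorb-half k {E} {B} E≤B+t =
  ≤-trans (+-cancelʳ-≤ E E (B + B) (fromℕ-cancel-≤ doubled)) (≤-reflexive (cong (B +_) (≡.sym (+-identityʳ B))))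
  where
  ε : ℚ
  ε = val (inv4k4 k)
  sE : ℕ
  sE = (suc k + suc k) * E
  t : ℚ
  t = ε ℚ.* fromℕ sE
  t+t≡E : t ℚ.+ t ≡ fromℕ E
  t+t≡E = begin
    t ℚ.+ t                                     ≡⟨ ≡.sym (ℚ.*-distribˡ-+ ε (fromℕ sE) (fromℕ sE)) ⟩
    ε ℚ.* (fromℕ sE ℚ.+ fromℕ sE)               ≡⟨ cong (ε ℚ.*_) (≡.sym (fromℕ-+ sE sE)) ⟩
    ε ℚ.* fromℕ (sE + sE)                       ≡⟨ cong (λ m → ε ℚ.* fromℕ m) (twice-2k+2≡4k+4 k E) ⟩
    ε ℚ.* fromℕ (suc (4 * k + 3) * E)           ≡⟨ cong (ε ℚ.*_) (fromℕ-* (suc (4 * k + 3)) E) ⟩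
    ε ℚ.* (fromℕ (suc (4 * k + 3)) ℚ.* fromℕ E) ≡⟨ ≡.sym (ℚ.*-assoc ε (fromℕ (suc (4 * k + 3))) (fromℕ E)) ⟩
    ε ℚ.* fromℕ (suc (4 * k + 3)) ℚ.* fromℕ E   ≡⟨ cong (ℚ._* fromℕ E) (inv4k4-inverse k) ⟩
    1ℚ ℚ.* fromℕ E                              ≡⟨ ℚ.*-identityˡ (fromℕ E) ⟩
    fromℕ E                                     ∎
    where open ≡.≡-Reasoning
  doubled : fromℕ (E + E) ℚ.≤ fromℕ (B + B + E)
  doubled = begin
    fromℕ (E + E)                          ≡⟨ fromℕ-+ E E ⟩
    fromℕ E ℚ.+ fromℕ E                    ≤⟨ ℚ.+-mono-≤ E≤B+t E≤B+t ⟩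
    (fromℕ B ℚ.+ t) ℚ.+ (fromℕ B ℚ.+ t)    ≡⟨ ℚ-interchange (fromℕ B) t (fromℕ B) t ⟩
    (fromℕ B ℚ.+ fromℕ B) ℚ.+ (t ℚ.+ t)    ≡⟨ cong₂ ℚ._+_ (≡.sym (fromℕ-+ B B)) t+t≡E ⟩
    fromℕ (B + B) ℚ.+ fromℕ E              ≡⟨ ≡.sym (fromℕ-+ (B + B) E) ⟩
    fromℕ (B + B + E)                      ∎
    where open ℚ.≤-Reasoning

lemma14 : (g : ℚ⁺ → ℕ → ℕ) (𝒢 : GraphClass) →
          FractionallyBeFragile 𝒢 g → ExpansionBoundedBy 𝒢 (fOf g)
lemma14 g 𝒢 fragile G G∈𝒢 k H M =
  subst (∣E∣ H ≤_) (≡.sym (*-assoc 2 (g ε k) (∣V∣ H)))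
        (absorb-half k (∣E∣-≤-via-packing {g ε} (ℚ.<⇒≤ (pos ε)) (fragile ε G G∈𝒢) M))
  where ε = inv4k4 k
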